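{- Let $G$ be a simple graph with $V(G)=\{x_1,\dots,x_n\}$, and let $M(G)$ have vertex set $\{x_1,\dots,x_n\}\cup\{x_1',\dots,x_n'\}\cup\{u\}$. If $M(G)$ has a $(k,d)$-partition, then it has a $(k,d)$-partition $(X_0,\dots,X_{k-1})$ such that (1) $X_0=\{u\}$, and (2) for every $x\in V(G)$, if $x\in X_i$ for some $i$ with $d\le i\le k-d$, then $\{x,x'\}\subseteq X_i$.
   Context: The Mycielski graph $M(G)$ has vertex set $\{x_1,\dots,x_n\}\cup\{x_1',\dots,x_n'\}\cup\{u\}$ and edge set $E(G)\cup\{x_i'x_j:x_ix_j\in E(G)\}\cup\{ux_i':1\le i\le n\}$; $x_i'$ is the twin of $x_i$ and $u$ is the root. For integers $k\ge 2d\ge 2$, a $(k,d)$-partition of a graph $H$ is a partition $(X_0,X_1,\dots,X_{k-1})$ of $V(H)$ (empty parts allowed) such that for every $j\in\{0,\dots,k-1\}$ the set $X_j\cup X_{j+1}\cup\cdots\cup X_{j+d-1}$ (indices mod $k$) is independent in $H$. -}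

module Defs where

open import Data.Nat using (ℕ; _<_; _≤_; _+_; _*_)
open import Data.Fin using (Fin; toℕ)
open import Data.Product using (Σ; _×_)
open import Data.Sum using (_⊎_)
open import Relation.Binary.PropositionalEquality using (_≡_)
open import Relation.Nullary using (¬_)

record SimpleGraph (n : ℕ) : Set₁ where
  field
    Adj   : Fin n → Fin n → Set
    sym   : ∀ {i j} → Adj i j → Adj j i
    irrefl : ∀ {i} → ¬ Adj i i

-- Vertices of the Mycielski graph M(G): x_i, its twin x_i', and the root u.
data MVertex (n : ℕ) : Set where
  orig : Fin n → MVertex n
  twin : Fin n → MVertex n
  root : MVertex n

-- Edges of M(G): E(G) ∪ {x_i' x_j : x_i x_j ∈ E(G)} ∪ {u x_i'}, symmetrically.
data MAdj {n : ℕ} (G : SimpleGraph n) : MVertex n → MVertex n → Set where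
  oo : ∀ {i j} → SimpleGraph.Adj G i j → MAdj G (orig i) (orig j)
  to : ∀ {i j} → SimpleGraph.Adj G i j → MAdj G (twin i) (orig j)
  ot : ∀ {i j} → SimpleGraph.Adj G i j → MAdj G (orig j) (twin i)
  ur : ∀ {i} → MAdj G root (twin i)
  ru : ∀ {i} → MAdj G (twin i) root

-- Part index i lies in the window {j, j+1, ..., j+d-1} (indices mod k).
-- i.e. i ≡ j + t (mod k) for some 0 ≤ t < d; since i, j < k and d ≤ k this
-- means toℕ i = toℕ j + t or toℕ i + k = toℕ j + t.
InWindow : (k d : ℕ) → Fin k → Fin k → Set
InWindow k d j i = Σ ℕ (λ t → (t < d) × ((toℕ i ≡ toℕ j + t) ⊎ (toℕ i + k ≡ toℕ j + t)))

-- A partition (X_0,...,X_{k-1}) of V(M(G)) (empty parts allowed) is encoded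
-- as the map sending each vertex to the index of its part.
IsKDPartition : {n : ℕ} (G : SimpleGraph n) (k d : ℕ) 
  → (MVertex n → Fin k) → Set
IsKDPartition {n} G k d X =
  ∀ (j : Fin k) (v w : MVertex n) → MAdj G v w
    → ¬ (InWindow k d j (X v) × InWindow k d j (X w))

module Submission where

open import Defs
open import Data.Nat using (ℕ; _≤_; _<_; _*_; _+_; _∸_; NonZero; >-nonZero; _≤?_; _<?_; _≟_)
open import Data.Nat.Properties
open import Data.Nat.DivMod using (_%_; _mod_; m%n<n; m<n⇒m%n≡m; [m+n]%n≡m%n; %-distribˡ-+; m%n%n≡m%n; n%n≡0)
open import Algebra.Properties.CommutativeSemigroup +-commutativeSemigroup using (xy∙z≈xz∙y)
open import Data.Fin using (Fin; toℕ)
open import Data.Fin.Properties using (toℕ<n; toℕ-fromℕ<; toℕ-injective)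
open import Data.Product using (Σ; ∃-syntax; _×_; _,_)
open import Data.Sum using (inj₁; inj₂)
open import Data.Empty using (⊥-elim)
open import Function using (_∘_)
open import Relation.Nullary using (¬_; Dec; yes; no)
open import Relation.Nullary.Decidable using (_×-dec_)
open import Relation.Unary using (Decidable)
open import Relation.Binary.PropositionalEquality

-- Call two parts compatible when no window of d consecutive parts contains
-- both; a (k,d)-partition sends adjacent vertices to compatible parts.
-- Windows are invariant under cyclic rotation, so u may be assumed to lie in
-- part 0, and the parts compatible with 0 are exactly the central ones,
-- d ≤ i ≤ k - d.  Now move the twin of each original vertex in a central
-- part into that part (it stays compatible with u, and its other neighbours
-- are neighbours of the original), and move each original vertex in part 0
-- into the part of its twin: the twin is not in part 0 as it is adjacent to
-- u, and the neighbours of the original are central vertices of G and their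
-- twins, which have just joined them.

Compatible : (k d : ℕ) → Fin k → Fin k → Set
Compatible k d a b = ∀ j → ¬ (InWindow k d j a × InWindow k d j b)

Central : (k d : ℕ) → Fin k → Set
Central k d c = d ≤ toℕ c × toℕ c + d ≤ k

module _ {k d : ℕ} where

  Compatible-sym : ∀ {a b} → Compatible k d a b → Compatible k d b a
  Compatible-sym compat j (p , q) = compat j (q , p)

  InWindow-refl : 1 ≤ d → (a : Fin k) → InWindow k d a a
  InWindow-refl 1≤d a = 0 , 1≤d , inj₁ (sym (+-identityʳ (toℕ a)))

  Compatible-irrefl : 1 ≤ d → ∀ {a} → ¬ Compatible k d a a
  Compatible-irrefl 1≤d {a} compat = compat a (InWindow-refl 1≤d a , InWindow-refl 1≤d a)

  central⇒≢0 : 1 ≤ d → ∀ {c} → Central k d c → toℕ c ≢ 0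
  central⇒≢0 1≤d (d≤c , _) c≡0 = <⇒≱ 1≤d (subst (d ≤_) c≡0 d≤c)

  central? : Decidable (Central k d)
  central? c = (d ≤? toℕ c) ×-dec (toℕ c + d ≤? k)

  compatible-with-zero⇒central : 1 ≤ d → ∀ {z c} → toℕ z ≡ 0 → Compatible k d z c → Central k d c
  compatible-with-zero⇒central 1≤d {z} {c} z≡0 compat =
    ≮⇒≥ (λ c<d → compat z (InWindow-refl 1≤d z , toℕ c , c<d , inj₁ (cong (_+ toℕ c) (sym z≡0)))) ,
    ≮⇒≥ (λ k<c+d → compat c ((k ∸ toℕ c , m<n+o⇒m∸n<o k (toℕ c) {{>-nonZero 1≤d}} k<c+d , inj₂ z+k≡c+[k∸c]) ,
                             InWindow-refl 1≤d c))
    where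
      z+k≡c+[k∸c] : toℕ z + k ≡ toℕ c + (k ∸ toℕ c)
      z+k≡c+[k∸c] = trans (cong (_+ k) z≡0) (sym (m+[n∸m]≡n (<⇒≤ (toℕ<n c))))

  central⇒compatible-with-zero : d ≤ k → ∀ {z c} → toℕ z ≡ 0 → Central k d c → Compatible k d z c
  central⇒compatible-with-zero d≤k {c = c} z≡0 (d≤c , _) j ((_ , _ , inj₁ z≡j+t) , (s , s<d , c∈j))
    with m+n≡0⇒m≡0 (toℕ j) (trans (sym z≡j+t) z≡0)
  ... | j≡0 with c∈j
  ...   | inj₁ c≡j+s   = <⇒≱ (subst (_< d) (sym (trans c≡j+s (cong (_+ s) j≡0))) s<d) d≤c
  ...   | inj₂ c+k≡j+s =
    <⇒≱ (≤-<-trans (m≤n+m k (toℕ c)) (subst (_< d) (sym (trans c+k≡j+s (cong (_+ s) j≡0))) s<d)) d≤k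
  central⇒compatible-with-zero _ {c = c} z≡0 (_ , c+d≤k) j ((t , t<d , inj₂ z+k≡j+t) , (s , _ , inj₁ c≡j+s)) =
    <⇒≱ (+-cancelʳ-< d (toℕ c) (toℕ j) c+d<j+d) (subst (toℕ j ≤_) (sym c≡j+s) (m≤m+n (toℕ j) s))
    where
      c+d<j+d : toℕ c + d < toℕ j + d
      c+d<j+d = ≤-<-trans (subst (toℕ c + d ≤_) (trans (cong (_+ k) (sym z≡0)) z+k≡j+t) c+d≤k)
                          (+-monoʳ-< (toℕ j) t<d)
  central⇒compatible-with-zero _ {c = c} _ (d≤c , _) j (_ , (s , s<d , inj₂ c+k≡j+s)) =
    <⇒≱ (+-cancelˡ-< k (toℕ c) d k+c<k+d) d≤c
    where
      k+c<k+d : k + toℕ c < k + d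
      k+c<k+d = subst (_< k + d) (trans (sym c+k≡j+s) (+-comm (toℕ c) k)) (+-mono-< (toℕ<n j) s<d)

module _ {k : ℕ} .{{_ : NonZero k}} where

  shift : ℕ → Fin k → Fin k
  shift s i = (toℕ i + s) mod k

  toℕ-shift : ∀ s i → toℕ (shift s i) ≡ (toℕ i + s) % k
  toℕ-shift s i = toℕ-fromℕ< (m%n<n (toℕ i + s) k)

  [m%k+n]%k≡[m+n]%k : ∀ m n → (m % k + n) % k ≡ (m + n) % k
  [m%k+n]%k≡[m+n]%k m n = begin
    (m % k + n) % k          ≡⟨ %-distribˡ-+ (m % k) n k ⟩
    (m % k % k + n % k) % k  ≡⟨ cong (λ r → (r + n % k) % k) (m%n%n≡m%n m k) ⟩
    (m % k + n % k) % k      ≡⟨ %-distribˡ-+ m n k ⟨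
    (m + n) % k              ∎
    where open ≡-Reasoning

  toℕ%k : (i : Fin k) → toℕ i % k ≡ toℕ i
  toℕ%k i = m<n⇒m%n≡m (toℕ<n i)

  InWindow⇒% : ∀ {d j i} → InWindow k d j i → ∃[ t ] t < d × (toℕ j + t) % k ≡ toℕ i
  InWindow⇒% {i = i} (t , t<d , inj₁ i≡j+t)   = t , t<d , trans (cong (_% k) (sym i≡j+t)) (toℕ%k i)
  InWindow⇒% {i = i} (t , t<d , inj₂ i+k≡j+t) =
    t , t<d , trans (cong (_% k) (sym i+k≡j+t)) (trans ([m+n]%n≡m%n (toℕ i) k) (toℕ%k i))

  %⇒InWindow : ∀ {d} → d ≤ k → ∀ {j i} t → t < d → (toℕ j + t) % k ≡ toℕ i → InWindow k d j i
  %⇒InWindow d≤k {j} {i} t t<d [j+t]%k≡i with toℕ j + t <? k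
  ... | yes j+t<k = t , t<d , inj₁ (trans (sym [j+t]%k≡i) (m<n⇒m%n≡m j+t<k))
  ... | no  j+t≮k = t , t<d , inj₂ i+k≡j+t
    where
      r : ℕ
      r = toℕ j + t ∸ k
      r+k≡j+t : r + k ≡ toℕ j + t
      r+k≡j+t = m∸n+n≡m (≮⇒≥ j+t≮k)
      r<k : r < k
      r<k = +-cancelʳ-< k r k (subst (_< k + k) (sym r+k≡j+t) (+-mono-< (toℕ<n j) (<-≤-trans t<d d≤k)))
      i≡r : toℕ i ≡ r
      i≡r = begin
        toℕ i            ≡⟨ [j+t]%k≡i ⟨
        (toℕ j + t) % k  ≡⟨ cong (_% k) r+k≡j+t ⟨
        (r + k) % k      ≡⟨ [m+n]%n≡m%n r k ⟩
        r % k            ≡⟨ m<n⇒m%n≡m r<k ⟩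
        r                ∎
        where open ≡-Reasoning
      i+k≡j+t : toℕ i + k ≡ toℕ j + t
      i+k≡j+t = trans (cong (_+ k) i≡r) r+k≡j+t

  InWindow-shift : ∀ {d} → d ≤ k → ∀ s {j i} → InWindow k d j i → InWindow k d (shift s j) (shift s i)
  InWindow-shift d≤k s {j} {i} i∈j with InWindow⇒% i∈j
  ... | t , t<d , [j+t]%k≡i = %⇒InWindow d≤k t t<d (begin
    (toℕ (shift s j) + t) % k  ≡⟨ cong (λ r → (r + t) % k) (toℕ-shift s j) ⟩
    ((toℕ j + s) % k + t) % k  ≡⟨ [m%k+n]%k≡[m+n]%k (toℕ j + s) t ⟩
    (toℕ j + s + t) % k        ≡⟨ cong (_% k) (xy∙z≈xz∙y (toℕ j) s t) ⟩
    (toℕ j + t + s) % k        ≡⟨ [m%k+n]%k≡[m+n]%k (toℕ j + t) s ⟨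
    ((toℕ j + t) % k + s) % k  ≡⟨ cong (λ r → (r + s) % k) [j+t]%k≡i ⟩
    (toℕ i + s) % k            ≡⟨ toℕ-shift s i ⟨
    toℕ (shift s i)            ∎)
    where open ≡-Reasoning

  shift-cancel : ∀ {s t} → s + t ≡ k → (a : Fin k) → shift t (shift s a) ≡ a
  shift-cancel {s} {t} s+t≡k a = toℕ-injective (begin
    toℕ (shift t (shift s a))  ≡⟨ toℕ-shift t (shift s a) ⟩
    (toℕ (shift s a) + t) % k  ≡⟨ cong (λ r → (r + t) % k) (toℕ-shift s a) ⟩
    ((toℕ a + s) % k + t) % k  ≡⟨ [m%k+n]%k≡[m+n]%k (toℕ a + s) t ⟩
    (toℕ a + s + t) % k        ≡⟨ cong (_% k) (trans (+-assoc (toℕ a) s t) (cong (toℕ a +_) s+t≡k)) ⟩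
    (toℕ a + k) % k            ≡⟨ [m+n]%n≡m%n (toℕ a) k ⟩
    toℕ a % k                  ≡⟨ toℕ%k a ⟩
    toℕ a                      ∎)
    where open ≡-Reasoning

  Compatible-shift : ∀ {d} → d ≤ k → ∀ {s t} → s + t ≡ k → ∀ {a b}
                   → Compatible k d a b → Compatible k d (shift s a) (shift s b)
  Compatible-shift d≤k {s} {t} s+t≡k {a} {b} compat j (a∈j , b∈j) =
    compat (shift t j) (unshift a a∈j , unshift b b∈j)
    where
      unshift : ∀ c → InWindow k _ j (shift s c) → InWindow k _ (shift t j) c
      unshift c c∈j = subst (InWindow k _ (shift t j)) (shift-cancel s+t≡k c) (InWindow-shift d≤k t c∈j)

  shift-to-zero : (a : Fin k) → toℕ (shift (k ∸ toℕ a) a) ≡ 0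
  shift-to-zero a = begin
    toℕ (shift (k ∸ toℕ a) a)  ≡⟨ toℕ-shift (k ∸ toℕ a) a ⟩
    (toℕ a + (k ∸ toℕ a)) % k  ≡⟨ cong (_% k) (m+[n∸m]≡n (<⇒≤ (toℕ<n a))) ⟩
    k % k                      ≡⟨ n%n≡0 k ⟩
    0                          ∎
    where open ≡-Reasoning

  rotate-root-to-zero : ∀ {n d} (G : SimpleGraph n) → d ≤ k → (X : MVertex n → Fin k) → IsKDPartition G k d X
                      → Σ (MVertex n → Fin k) (λ Y → IsKDPartition G k d Y × toℕ (Y root) ≡ 0)
  rotate-root-to-zero G d≤k X isX =
    shift (k ∸ r) ∘ X ,
    (λ j v w e → Compatible-shift d≤k (m∸n+n≡m r≤k) (λ i → isX i v w e) j) ,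
    shift-to-zero (X root)
    where
      r : ℕ
      r = toℕ (X root)
      r≤k : r ≤ k
      r≤k = <⇒≤ (toℕ<n (X root))

module TwinMerge {n k d : ℕ} (G : SimpleGraph n) (1≤d : 1 ≤ d) (d≤k : d ≤ k)
  (X : MVertex n → Fin k) (isX : IsKDPartition G k d X) (root-at-0 : toℕ (X root) ≡ 0) where

  open SimpleGraph G using (Adj) renaming (sym to Adj-sym)

  edge : ∀ {v w} → MAdj G v w → Compatible k d (X v) (X w)
  edge {v} {w} e j = isX j v w e

  ¬compatible-at-zero : ∀ {a b} → toℕ a ≡ 0 → toℕ b ≡ 0 → ¬ Compatible k d a b
  ¬compatible-at-zero a≡0 b≡0 compat =
    Compatible-irrefl 1≤d (subst (Compatible k d _) (sym (toℕ-injective (trans a≡0 (sym b≡0)))) compat)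

  twin-not-at-zero : ∀ x → toℕ (X (twin x)) ≢ 0
  twin-not-at-zero x t≡0 = ¬compatible-at-zero root-at-0 t≡0 (edge ur)

  twinPart : (x : Fin n) → Dec (Central k d (X (orig x))) → Fin k
  twinPart x (yes _) = X (orig x)
  twinPart x (no _)  = X (twin x)

  origPart : (x : Fin n) → Dec (toℕ (X (orig x)) ≡ 0) → Fin k
  origPart x (yes _) = X (twin x)
  origPart x (no _)  = X (orig x)

  orig-at-zero? : ∀ x → Dec (toℕ (X (orig x)) ≡ 0)
  orig-at-zero? x = toℕ (X (orig x)) ≟ 0

  orig-central? : ∀ x → Dec (Central k d (X (orig x)))
  orig-central? x = central? (X (orig x))

  Y : MVertex n → Fin k
  Y (orig x) = origPart x (orig-at-zero? x)
  Y (twin x) = twinPart x (orig-central? x)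
  Y root     = X root

  origPart-compatible : ∀ {x y} → Adj x y → ∀ p q → Compatible k d (origPart x p) (origPart y q)
  origPart-compatible e (yes x≡0) (yes y≡0) = ⊥-elim (¬compatible-at-zero x≡0 y≡0 (edge (oo e)))
  origPart-compatible e (yes _)   (no _)    = edge (to e)
  origPart-compatible e (no _)    (yes _)   = edge (ot (Adj-sym e))
  origPart-compatible e (no _)    (no _)    = edge (oo e)

  twinPart-origPart-compatible : ∀ {x y} → Adj x y → ∀ p q → Compatible k d (twinPart x p) (origPart y q)
  twinPart-origPart-compatible e (yes _)   (yes _)   = edge (ot (Adj-sym e))
  twinPart-origPart-compatible e (yes _)   (no _)    = edge (oo e)
  twinPart-origPart-compatible e (no ¬cen) (yes y≡0) =
    ⊥-elim (¬cen (compatible-with-zero⇒central 1≤d y≡0 (Compatible-sym (edge (oo e)))))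
  twinPart-origPart-compatible e (no _)    (no _)    = edge (to e)

  root-twinPart-compatible : ∀ x p → Compatible k d (X root) (twinPart x p)
  root-twinPart-compatible x (yes cen) = central⇒compatible-with-zero d≤k root-at-0 cen
  root-twinPart-compatible x (no _)    = edge ur

  isY : IsKDPartition G k d Y
  isY j (orig x) (orig y) (oo e) = origPart-compatible e (orig-at-zero? x) (orig-at-zero? y) j
  isY j (twin x) (orig y) (to e) = twinPart-origPart-compatible e (orig-central? x) (orig-at-zero? y) j
  isY j (orig y) (twin x) (ot e) = Compatible-sym (twinPart-origPart-compatible e (orig-central? x) (orig-at-zero? y)) j
  isY j root     (twin x) ur     = root-twinPart-compatible x (orig-central? x) j
  isY j (twin x) root     ru     = Compatible-sym (root-twinPart-compatible x (orig-central? x)) j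

  twinPart-not-at-zero : ∀ x p → toℕ (twinPart x p) ≢ 0
  twinPart-not-at-zero x (yes cen) = central⇒≢0 1≤d cen
  twinPart-not-at-zero x (no _)   = twin-not-at-zero x

  origPart-not-at-zero : ∀ x p → toℕ (origPart x p) ≢ 0
  origPart-not-at-zero x (yes _)   = twin-not-at-zero x
  origPart-not-at-zero x (no c≢0)  = c≢0

  Y-at-zero⇒root : ∀ v → toℕ (Y v) ≡ 0 → v ≡ root
  Y-at-zero⇒root (orig x) Yx≡0 = ⊥-elim (origPart-not-at-zero x (orig-at-zero? x) Yx≡0)
  Y-at-zero⇒root (twin x) Yx≡0 = ⊥-elim (twinPart-not-at-zero x (orig-central? x) Yx≡0)
  Y-at-zero⇒root root     _    = refl

  twinPart-joins-central : ∀ x p q → Central k d (origPart x q) → twinPart x p ≡ origPart x q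
  twinPart-joins-central x (yes cen) (yes c≡0) _   = ⊥-elim (central⇒≢0 1≤d cen c≡0)
  twinPart-joins-central x (yes _)   (no _)    _   = refl
  twinPart-joins-central x (no _)    (yes _)   _   = refl
  twinPart-joins-central x (no ¬cen) (no _)    cen = ⊥-elim (¬cen cen)

  Y-twin-joins-central : ∀ x → Central k d (Y (orig x)) → Y (twin x) ≡ Y (orig x)
  Y-twin-joins-central x = twinPart-joins-central x (orig-central? x) (orig-at-zero? x)

lemma10 : (n : ℕ) (G : SimpleGraph n) (k d : ℕ)
    → 1 ≤ d → 2 * d ≤ k
    → Σ (MVertex n → Fin k) (λ X → IsKDPartition G k d X)
    → Σ (MVertex n → Fin k) (λ X →
        IsKDPartition G k d X
        × (∀ v → toℕ (X v) ≡ 0 → v ≡ root)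
        × toℕ (X root) ≡ 0
        × (∀ (x : Fin n) → d ≤ toℕ (X (orig x)) → toℕ (X (orig x)) + d ≤ k
             → X (twin x) ≡ X (orig x)))
lemma10 n G k d 1≤d 2d≤k (X , isX) =
  let (X₀ , isX₀ , root-at-0) = rotate-root-to-zero G d≤k X isX
      open TwinMerge G 1≤d d≤k X₀ isX₀ root-at-0
  in Y , isY , Y-at-zero⇒root , root-at-0 , λ x d≤c c+d≤k → Y-twin-joins-central x (d≤c , c+d≤k)
  where
    d≤k : d ≤ k
    d≤k = ≤-trans (m≤m+n d (d + 0)) 2d≤k
    instance
      k-nonZero : NonZero k
      k-nonZero = >-nonZero (≤-trans 1≤d d≤k)
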